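{- Let $\mathbf{C}$ be an extensive category with finite products, a stable natural number object $\mathbb{N}$ and exponentials $X^{\mathbb{N}}$. Then the delay monad $\mathbb{D}$ on $\mathbf{C}$ is commutative, i.e. for all objects $X,Y$, $$\hat\tau^{*}\circ\tau=\tau^{*}\circ\hat\tau\colon DX\times DY\to D(X\times Y),$$ where $\tau\colon DX\times DY\to D(DX\times Y)$ and $\hat\tau\colon DX\times DY\to D(X\times DY)$ are the strength and its dual, and $(-)^*$ is Kleisli lifting of $\mathbb{D}$.
   Context: $\mathbf{C}$ is extensive: finite coproducts exist, are disjoint and stable under pullback. A stable natural number object is $(\mathbb{N},o\colon 1\to\mathbb{N},s\colon\mathbb{N}\to\mathbb{N})$ such that for all $f\colon X\to Y$, $g\colon Y\to Y$ there is a unique $h\colon X\times\mathbb{N}\to Y$ with $h\langle\mathrm{id},o\,!\rangle=f$ and $h(\mathrm{id}\times s)=gh$. $\mathrm{dstr}\colon X\times(Y+Z)\to X\times Y+X\times Z$ is the inverse of $[\mathrm{id}\times\mathrm{inl},\mathrm{id}\times\mathrm{inr}]$. For each $X$, $DX$ is the final coalgebra of the functor $X+(-)$ (it exists under these assumptions), with structure $\mathrm{out}\colon DX\to X+DX$ (an isomorphism); $\mathrm{now}=\mathrm{out}^{ -1}\mathrm{inl}$, $\mathrm{later}=\mathrm{out}^{ -1}\mathrm{inr}$. The delay monad $\mathbb{D}$ has unit $\mathrm{now}$ and Kleisli lifting of $f\colon X\to DY$ the unique $f^*\colon DX\to DY$ with $\mathrm{out}\,f^*=[\mathrm{out}\,f,\mathrm{inr}\,f^*]\,\mathrm{out}$.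 Its strength $\tau\colon X\times DY\to D(X\times Y)$ is the unique morphism with $\mathrm{out}\,\tau=(\mathrm{id}+\tau)\,\mathrm{dstr}\,(\mathrm{id}\times\mathrm{out})$; the dual strength $\hat\tau\colon DX\times Y\to D(X\times Y)$ is obtained from $\tau$ by conjugating with the symmetry isomorphisms of $\times$. -}

module Defs where

open import Level using (Level; _⊔_) renaming (suc to lsuc)
open import Relation.Binary using (IsEquivalence)

record Category (o ℓ e : Level) : Set (lsuc (o ⊔ ℓ ⊔ e)) where
  infixr 9 _∘_
  infix  4 _≈_
  infixr 5 _⇒_
  field
    Obj  : Set o
    _⇒_  : Obj → Obj → Set ℓ
    _≈_  : ∀ {A B} → A ⇒ B → A ⇒ B → Set e
    id   : ∀ {A} → A ⇒ A
    _∘_  : ∀ {A B C} → B ⇒ C → A ⇒ B → A ⇒ C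
    equiv     : ∀ {A B} → IsEquivalence (_≈_ {A} {B})
    ∘-resp-≈  : ∀ {A B C} {f h : B ⇒ C} {g i : A ⇒ B} → f ≈ h → g ≈ i → f ∘ g ≈ h ∘ i
    assoc     : ∀ {A B C D} {f : A ⇒ B} {g : B ⇒ C} {h : C ⇒ D} →
                (h ∘ g) ∘ f ≈ h ∘ (g ∘ f)
    identityˡ : ∀ {A B} {f : A ⇒ B} → id ∘ f ≈ f
    identityʳ : ∀ {A B} {f : A ⇒ B} → f ∘ id ≈ f

module Structures {o ℓ e : Level} (C : Category o ℓ e) where
  open Category C

  record Terminal : Set (o ⊔ ℓ ⊔ e) where
    field
      ⊤        : Obj
      !        : ∀ {A} → A ⇒ ⊤
      !-unique : ∀ {A} (f : A ⇒ ⊤) → ! ≈ f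

  record Initial : Set (o ⊔ ℓ ⊔ e) where
    field
      ⊥        : Obj
      ¡        : ∀ {A} → ⊥ ⇒ A
      ¡-unique : ∀ {A} (f : ⊥ ⇒ A) → ¡ ≈ f

  record BinaryProducts : Set (o ⊔ ℓ ⊔ e) where
    infixr 7 _×_
    field
      _×_       : Obj → Obj → Obj
      π₁        : ∀ {A B} → A × B ⇒ A
      π₂        : ∀ {A B} → A × B ⇒ B
      ⟨_,_⟩     : ∀ {A B X} → X ⇒ A → X ⇒ B → X ⇒ A × B
      project₁  : ∀ {A B X} {f : X ⇒ A} {g : X ⇒ B} → π₁ ∘ ⟨ f , g ⟩ ≈ f
      project₂  : ∀ {A B X} {f : X ⇒ A} {g : X ⇒ B} → π₂ ∘ ⟨ f , g ⟩ ≈ g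
      ⟨⟩-unique : ∀ {A B X} {f : X ⇒ A} {g : X ⇒ B} {h : X ⇒ A × B} →
                  π₁ ∘ h ≈ f → π₂ ∘ h ≈ g → ⟨ f , g ⟩ ≈ h

    infixr 8 _⁂_
    _⁂_ : ∀ {A B A' B'} → A ⇒ A' → B ⇒ B' → A × B ⇒ A' × B'
    f ⁂ g = ⟨ f ∘ π₁ , g ∘ π₂ ⟩

    swap : ∀ {A B} → A × B ⇒ B × A
    swap = ⟨ π₂ , π₁ ⟩

  record IsCoproduct {A B S : Obj} (j₁ : A ⇒ S) (j₂ : B ⇒ S) : Set (o ⊔ ℓ ⊔ e) where
    field
      copair    : ∀ {W} → A ⇒ W → B ⇒ W → S ⇒ W
      inject₁   : ∀ {W} {f : A ⇒ W} {g : B ⇒ W} → copair f g ∘ j₁ ≈ f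
      inject₂   : ∀ {W} {f : A ⇒ W} {g : B ⇒ W} → copair f g ∘ j₂ ≈ g
      unique    : ∀ {W} {f : A ⇒ W} {g : B ⇒ W} {h : S ⇒ W} →
                  h ∘ j₁ ≈ f → h ∘ j₂ ≈ g → copair f g ≈ h

  record BinaryCoproducts : Set (o ⊔ ℓ ⊔ e) where
    infixr 6 _+_
    field
      _+_       : Obj → Obj → Obj
      i₁        : ∀ {A B} → A ⇒ A + B
      i₂        : ∀ {A B} → B ⇒ A + B
      [_,_]     : ∀ {A B X} → A ⇒ X → B ⇒ X → A + B ⇒ X
      inject₁   : ∀ {A B X} {f : A ⇒ X} {g : B ⇒ X} → [ f , g ] ∘ i₁ ≈ f
      inject₂   : ∀ {A B X} {f : A ⇒ X} {g : B ⇒ X} → [ f , g ] ∘ i₂ ≈ g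
      []-unique : ∀ {A B X} {f : A ⇒ X} {g : B ⇒ X} {h : A + B ⇒ X} →
                  h ∘ i₁ ≈ f → h ∘ i₂ ≈ g → [ f , g ] ≈ h

    infixr 7 _+₁_
    _+₁_ : ∀ {A B A' B'} → A ⇒ A' → B ⇒ B' → A + B ⇒ A' + B'
    f +₁ g = [ i₁ ∘ f , i₂ ∘ g ]

  record IsPullback {P X Y Z : Obj} (p₁ : P ⇒ X) (p₂ : P ⇒ Y)
                    (f : X ⇒ Z) (g : Y ⇒ Z) : Set (o ⊔ ℓ ⊔ e) where
    field
      commute   : f ∘ p₁ ≈ g ∘ p₂
      universal : ∀ {Q} {q₁ : Q ⇒ X} {q₂ : Q ⇒ Y} → f ∘ q₁ ≈ g ∘ q₂ → Q ⇒ P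
      p₁∘universal : ∀ {Q} {q₁ : Q ⇒ X} {q₂ : Q ⇒ Y} (eq : f ∘ q₁ ≈ g ∘ q₂) →
                     p₁ ∘ universal eq ≈ q₁
      p₂∘universal : ∀ {Q} {q₁ : Q ⇒ X} {q₂ : Q ⇒ Y} (eq : f ∘ q₁ ≈ g ∘ q₂) →
                     p₂ ∘ universal eq ≈ q₂
      unique-diagram : ∀ {Q} {h i : Q ⇒ P} →
                       p₁ ∘ h ≈ p₁ ∘ i → p₂ ∘ h ≈ p₂ ∘ i → h ≈ i

  record Pullback {X Y Z : Obj} (f : X ⇒ Z) (g : Y ⇒ Z) : Set (o ⊔ ℓ ⊔ e) where
    field
      P          : Obj
      p₁         : P ⇒ X
      p₂         : P ⇒ Y
      isPullback : IsPullback p₁ p₂ f g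

  record Extensive : Set (o ⊔ ℓ ⊔ e) where
    field
      initial    : Initial
      coproducts : BinaryCoproducts
    open Initial initial
    open BinaryCoproducts coproducts
    field
      pullback₁ : ∀ {A B Z} (f : Z ⇒ A + B) → Pullback f i₁
      pullback₂ : ∀ {A B Z} (f : Z ⇒ A + B) → Pullback f i₂
      disjoint  : ∀ {A B} → IsPullback (¡ {A}) (¡ {B}) (i₁ {A} {B}) (i₂ {A} {B})
      stable    : ∀ {A B Z} {f : Z ⇒ A + B}
                  (P₁ : Pullback f i₁) (P₂ : Pullback f i₂) →
                  IsCoproduct (Pullback.p₁ P₁) (Pullback.p₁ P₂)
      -- stability of the empty coproduct: the initial object is strict
      strict    : ∀ {A} (f : A ⇒ ⊥) → ¡ ∘ f ≈ id

  module _ (T : Terminal) (Pr : BinaryProducts) where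
    open Terminal T
    open BinaryProducts Pr

    record StableNNO : Set (o ⊔ ℓ ⊔ e) where
      field
        ℕ    : Obj
        z    : ⊤ ⇒ ℕ
        s    : ℕ ⇒ ℕ
        rec  : ∀ {X Y} → X ⇒ Y → Y ⇒ Y → X × ℕ ⇒ Y
        rec-z : ∀ {X Y} {f : X ⇒ Y} {g : Y ⇒ Y} → rec f g ∘ ⟨ id , z ∘ ! ⟩ ≈ f
        rec-s : ∀ {X Y} {f : X ⇒ Y} {g : Y ⇒ Y} → rec f g ∘ (id ⁂ s) ≈ g ∘ rec f g
        rec-unique : ∀ {X Y} {f : X ⇒ Y} {g : Y ⇒ Y} {h : X × ℕ ⇒ Y} →
                     h ∘ ⟨ id , z ∘ ! ⟩ ≈ f → h ∘ (id ⁂ s) ≈ g ∘ h → h ≈ rec f g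

    record Exponential (X B : Obj) : Set (o ⊔ ℓ ⊔ e) where
      field
        X^B     : Obj
        eval    : X^B × B ⇒ X
        curry   : ∀ {Z} → Z × B ⇒ X → Z ⇒ X^B
        β       : ∀ {Z} {f : Z × B ⇒ X} → eval ∘ (curry f ⁂ id) ≈ f
        λ-unique : ∀ {Z} {f : Z × B ⇒ X} {h : Z ⇒ X^B} →
                   eval ∘ (h ⁂ id) ≈ f → h ≈ curry f

  module _ (K : BinaryCoproducts) where
    open BinaryCoproducts K

    record FinalCoalgebra (X : Obj) : Set (o ⊔ ℓ ⊔ e) where
      field
        D       : Obj
        out     : D ⇒ X + D
        unfold  : ∀ {A} → A ⇒ X + A → A ⇒ D
        unfold-commute : ∀ {A} {c : A ⇒ X + A} → out ∘ unfold c ≈ (id +₁ unfold c) ∘ c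
        unfold-unique  : ∀ {A} {c : A ⇒ X + A} {h : A ⇒ D} →
                         out ∘ h ≈ (id +₁ h) ∘ c → h ≈ unfold c

module Delay {o ℓ e : Level} (C : Category o ℓ e)
             (Pr : Structures.BinaryProducts C)
             (K  : Structures.BinaryCoproducts C)
             (F  : ∀ X → Structures.FinalCoalgebra C K X)
             (dstr : ∀ {X Y Z} → Category._⇒_ C
                       (Structures.BinaryProducts._×_ Pr X (Structures.BinaryCoproducts._+_ K Y Z))
                       (Structures.BinaryCoproducts._+_ K
                          (Structures.BinaryProducts._×_ Pr X Y)
                          (Structures.BinaryProducts._×_ Pr X Z)))
             where
  open Category C
  open Structures C
  open BinaryProducts Pr
  open BinaryCoproducts K

  D : Obj → Obj
  D X = FinalCoalgebra.D (F X)

  out : ∀ {X} → D X ⇒ X + D X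
  out {X} = FinalCoalgebra.out (F X)

  unfold : ∀ {X A} → A ⇒ X + A → A ⇒ D X
  unfold {X} = FinalCoalgebra.unfold (F X)

  -- Kleisli lifting f* : the unique morphism with out ∘ f* ≈ [ out ∘ f , i₂ ∘ f* ] ∘ out,
  -- constructed by coiteration on D X + D Y (first summand: still running the input,
  -- second summand: copying the output of f).
  _* : ∀ {X Y} → X ⇒ D Y → D X ⇒ D Y
  _* {X} {Y} f = unfold {Y} {D X + D Y}
                   [ [ (id +₁ i₂) ∘ out ∘ f , i₂ ∘ i₁ ] ∘ out , (id +₁ i₂) ∘ out ] ∘ i₁

  Dmap : ∀ {X Y} → X ⇒ Y → D X ⇒ D Y
  Dmap f = unfold ((f +₁ id) ∘ out)

  τ : ∀ {X Y} → X × D Y ⇒ D (X × Y)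
  τ {X} {Y} = unfold {X × Y} {X × D Y} (dstr ∘ (id ⁂ out))

  τ̂ : ∀ {X Y} → D X × Y ⇒ D (X × Y)
  τ̂ = Dmap swap ∘ τ ∘ swap

  Commutative : Set (o ⊔ e)
  Commutative = ∀ {X Y} → (τ̂ {X} {Y}) * ∘ τ {D X} {Y} ≈ (τ {X} {Y}) * ∘ τ̂ {X} {D Y}

-- A morphism h : D X × D Y → D Z commuting with later in each argument is determined by
-- h ∘ (now ⁂ now): on (now x , later q) it must emit a step and continue at (now x , q), and
-- on (later p , q) emit a step and continue at (p , q), so uniqueness of apomorphisms out of
-- A × D B ≅ A × B + A × D B pins it down. Both τ̂* ∘ τ and τ* ∘ τ̂ send (now x , now y) to
-- now (x , y); each visibly commutes with later in one argument, and that uniqueness, applied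
-- once more, yields commutation in the other.
module Submission where

open import Level using (Level)
open import Relation.Binary using (IsEquivalence; Setoid)
import Relation.Binary.Reasoning.Setoid as SetoidReasoning
open import Defs
open Defs.Structures using (Terminal; BinaryProducts; Extensive; StableNNO; Exponential; FinalCoalgebra; BinaryCoproducts)

module HomLemmas {o ℓ e : Level} (C : Category o ℓ e) where
  open Category C

  module _ {A B : Obj} where
    open IsEquivalence (equiv {A} {B}) public using (refl; sym; trans)

  hom-setoid : Obj → Obj → Setoid ℓ e
  hom-setoid A B = record { Carrier = A ⇒ B ; _≈_ = _≈_ ; isEquivalence = equiv }

  module HomReasoning {A B : Obj} = SetoidReasoning (hom-setoid A B)
  open HomReasoning public using (begin_; _∎; step-≈-⟩; step-≈-⟨)

  infixr 4 _⟩∘⟨_ refl⟩∘⟨_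
  infixl 5 _⟩∘⟨refl

  _⟩∘⟨_ : ∀ {A B W} {f h : B ⇒ W} {g i : A ⇒ B} → f ≈ h → g ≈ i → f ∘ g ≈ h ∘ i
  _⟩∘⟨_ = ∘-resp-≈

  refl⟩∘⟨_ : ∀ {A B W} {f : B ⇒ W} {g i : A ⇒ B} → g ≈ i → f ∘ g ≈ f ∘ i
  refl⟩∘⟨_ = refl ⟩∘⟨_

  _⟩∘⟨refl : ∀ {A B W} {f h : B ⇒ W} {g : A ⇒ B} → f ≈ h → f ∘ g ≈ h ∘ g
  p ⟩∘⟨refl = p ⟩∘⟨ refl

  sym-assoc : ∀ {A B W Z} {f : A ⇒ B} {g : B ⇒ W} {h : W ⇒ Z} → h ∘ (g ∘ f) ≈ (h ∘ g) ∘ f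
  sym-assoc = sym assoc

  pullˡ : ∀ {A B W Z} {a : W ⇒ Z} {b : B ⇒ W} {c : B ⇒ Z} {f : A ⇒ B} → a ∘ b ≈ c → a ∘ (b ∘ f) ≈ c ∘ f
  pullˡ p = trans sym-assoc (p ⟩∘⟨refl)

  pullʳ : ∀ {A B W Z} {a : W ⇒ Z} {b : B ⇒ W} {f : A ⇒ B} {c : A ⇒ W} → b ∘ f ≈ c → (a ∘ b) ∘ f ≈ a ∘ c
  pullʳ p = trans assoc (refl⟩∘⟨ p)

  pushʳ : ∀ {A B W Z} {a : W ⇒ Z} {b : B ⇒ W} {f : A ⇒ B} {c : A ⇒ W} → b ∘ f ≈ c → a ∘ c ≈ (a ∘ b) ∘ f
  pushʳ p = sym (pullʳ p)

  extendʳ : ∀ {A B B' W Z} {a : B ⇒ W} {b : A ⇒ B} {c : B' ⇒ W} {d : A ⇒ B'} {f : W ⇒ Z} →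
            a ∘ b ≈ c ∘ d → (f ∘ a) ∘ b ≈ (f ∘ c) ∘ d
  extendʳ p = trans (pullʳ p) sym-assoc

  module _ {A B : Obj} {a : B ⇒ A} {b : A ⇒ B} (ab : a ∘ b ≈ id) where
    cancelˡ : ∀ {W} {f : W ⇒ A} → a ∘ (b ∘ f) ≈ f
    cancelˡ = trans (pullˡ ab) identityˡ

    cancelʳ : ∀ {W} {f : A ⇒ W} → (f ∘ a) ∘ b ≈ f
    cancelʳ = trans (pullʳ ab) identityʳ

    section⇒mono : ∀ {W} {f g : W ⇒ A} → b ∘ f ≈ b ∘ g → f ≈ g
    section⇒mono p = trans (sym cancelˡ) (trans (refl⟩∘⟨ p) cancelˡ)

    retraction⇒epi : ∀ {W} {f g : A ⇒ W} → f ∘ a ≈ g ∘ a → f ≈ g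
    retraction⇒epi p = trans (sym cancelʳ) (trans (p ⟩∘⟨refl) cancelʳ)

module ProductLemmas {o ℓ e : Level} {C : Category o ℓ e} (Pr : BinaryProducts C) where
  open Category C
  open HomLemmas C
  open BinaryProducts Pr

  ⟨⟩∘ : ∀ {A B X W} {f : X ⇒ A} {g : X ⇒ B} {h : W ⇒ X} → ⟨ f , g ⟩ ∘ h ≈ ⟨ f ∘ h , g ∘ h ⟩
  ⟨⟩∘ = sym (⟨⟩-unique (pullˡ project₁) (pullˡ project₂))

  ⟨⟩-cong₂ : ∀ {A B X} {f f' : X ⇒ A} {g g' : X ⇒ B} → f ≈ f' → g ≈ g' → ⟨ f , g ⟩ ≈ ⟨ f' , g' ⟩
  ⟨⟩-cong₂ p q = ⟨⟩-unique (trans project₁ (sym p)) (trans project₂ (sym q))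

  ⁂-cong₂ : ∀ {A B A' B'} {f f' : A ⇒ A'} {g g' : B ⇒ B'} → f ≈ f' → g ≈ g' → f ⁂ g ≈ f' ⁂ g'
  ⁂-cong₂ p q = ⟨⟩-cong₂ (p ⟩∘⟨refl) (q ⟩∘⟨refl)

  ⁂∘⁂ : ∀ {A B A' B' A'' B''} {f : A' ⇒ A''} {g : B' ⇒ B''} {h : A ⇒ A'} {k : B ⇒ B'} →
        (f ⁂ g) ∘ (h ⁂ k) ≈ (f ∘ h) ⁂ (g ∘ k)
  ⁂∘⁂ = trans ⟨⟩∘ (⟨⟩-cong₂ (trans (pullʳ project₁) sym-assoc) (trans (pullʳ project₂) sym-assoc))

  ⁂-identity : ∀ {A B} → id {A} ⁂ id {B} ≈ id
  ⁂-identity = ⟨⟩-unique (trans identityʳ (sym identityˡ)) (trans identityʳ (sym identityˡ))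

  second∘second : ∀ {A B B' B''} {f : B' ⇒ B''} {g : B ⇒ B'} → (id {A} ⁂ f) ∘ (id ⁂ g) ≈ id ⁂ (f ∘ g)
  second∘second = trans ⁂∘⁂ (⁂-cong₂ identityˡ refl)

  first∘second : ∀ {A A' B B'} {f : A ⇒ A'} {g : B ⇒ B'} → (f ⁂ id) ∘ (id ⁂ g) ≈ f ⁂ g
  first∘second = trans ⁂∘⁂ (⁂-cong₂ identityʳ identityˡ)

  second∘first : ∀ {A A' B B'} {f : A ⇒ A'} {g : B ⇒ B'} → (id ⁂ g) ∘ (f ⁂ id) ≈ f ⁂ g
  second∘first = trans ⁂∘⁂ (⁂-cong₂ identityˡ identityʳ)

  first↔second : ∀ {A A' B B'} {f : A ⇒ A'} {g : B ⇒ B'} → (f ⁂ id) ∘ (id ⁂ g) ≈ (id ⁂ g) ∘ (f ⁂ id)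
  first↔second = trans first∘second (sym second∘first)

  swap∘⁂ : ∀ {A B A' B'} {f : A ⇒ A'} {g : B ⇒ B'} → swap ∘ (f ⁂ g) ≈ (g ⁂ f) ∘ swap
  swap∘⁂ = trans ⟨⟩∘ (trans (⟨⟩-cong₂ project₂ project₁) (sym (trans ⟨⟩∘ (⟨⟩-cong₂ (pullʳ project₁) (pullʳ project₂)))))

  swap∘swap : ∀ {A B} → swap {A} {B} ∘ swap ≈ id
  swap∘swap = trans ⟨⟩∘ (trans (⟨⟩-cong₂ project₂ project₁) (⟨⟩-unique identityʳ identityʳ))

module CoproductLemmas {o ℓ e : Level} {C : Category o ℓ e} (K : BinaryCoproducts C) where
  open Category C
  open HomLemmas C
  open BinaryCoproducts K

  ∘[] : ∀ {A B X Y} {f : A ⇒ X} {g : B ⇒ X} {h : X ⇒ Y} → h ∘ [ f , g ] ≈ [ h ∘ f , h ∘ g ]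
  ∘[] = sym ([]-unique (pullʳ inject₁) (pullʳ inject₂))

  []-cong₂ : ∀ {A B X} {f f' : A ⇒ X} {g g' : B ⇒ X} → f ≈ f' → g ≈ g' → [ f , g ] ≈ [ f' , g' ]
  []-cong₂ p q = []-unique (trans inject₁ (sym p)) (trans inject₂ (sym q))

  +-jointly-epic : ∀ {A B X} {h h' : A + B ⇒ X} → h ∘ i₁ ≈ h' ∘ i₁ → h ∘ i₂ ≈ h' ∘ i₂ → h ≈ h'
  +-jointly-epic p q = trans (sym ([]-unique refl refl)) ([]-unique (sym p) (sym q))

  +₁-cong₂ : ∀ {A B A' B'} {f f' : A ⇒ A'} {g g' : B ⇒ B'} → f ≈ f' → g ≈ g' → f +₁ g ≈ f' +₁ g'
  +₁-cong₂ p q = []-cong₂ (refl⟩∘⟨ p) (refl⟩∘⟨ q)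

  +₁∘+₁ : ∀ {A B A' B' A'' B''} {f : A' ⇒ A''} {g : B' ⇒ B''} {h : A ⇒ A'} {k : B ⇒ B'} →
          (f +₁ g) ∘ (h +₁ k) ≈ (f ∘ h) +₁ (g ∘ k)
  +₁∘+₁ = trans ∘[] ([]-cong₂ (trans (pullˡ inject₁) assoc) (trans (pullˡ inject₂) assoc))

  +₁-identity : ∀ {A B} → id {A} +₁ id {B} ≈ id
  +₁-identity = []-unique (trans identityˡ (sym identityʳ)) (trans identityˡ (sym identityʳ))

  id+₁∘id+₁ : ∀ {A B B' B''} {f : B' ⇒ B''} {g : B ⇒ B'} → (id {A} +₁ f) ∘ (id +₁ g) ≈ id +₁ (f ∘ g)
  id+₁∘id+₁ = trans +₁∘+₁ (+₁-cong₂ identityˡ refl)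

module FinalCoalgebraLemmas {o ℓ e : Level} {C : Category o ℓ e} {K : BinaryCoproducts C} {X : Category.Obj C}
                            (FC : FinalCoalgebra C K X) where
  open Category C
  open HomLemmas C
  open BinaryCoproducts K
  open CoproductLemmas K
  open FinalCoalgebra FC

  unfold-unique₂ : ∀ {A} {c : A ⇒ X + A} {h h' : A ⇒ D} →
                   out ∘ h ≈ (id +₁ h) ∘ c → out ∘ h' ≈ (id +₁ h') ∘ c → h ≈ h'
  unfold-unique₂ p p' = trans (unfold-unique p) (sym (unfold-unique p'))

  coalgebra-endo≈id : ∀ {h : D ⇒ D} → out ∘ h ≈ (id +₁ h) ∘ out → h ≈ id
  coalgebra-endo≈id p = unfold-unique₂ p (trans identityʳ (sym (trans (+₁-identity ⟩∘⟨refl) identityˡ)))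

  out∘unfold∘ : ∀ {A B} {c : A ⇒ X + A} {j : B ⇒ A} → out ∘ (unfold c ∘ j) ≈ (id +₁ unfold c) ∘ (c ∘ j)
  out∘unfold∘ = trans (pullˡ unfold-commute) assoc

  out⁻¹ : X + D ⇒ D
  out⁻¹ = unfold (id +₁ out)

  out⁻¹∘out : out⁻¹ ∘ out ≈ id
  out⁻¹∘out = coalgebra-endo≈id (trans out∘unfold∘ (trans sym-assoc (id+₁∘id+₁ ⟩∘⟨refl)))

  out∘out⁻¹ : out ∘ out⁻¹ ≈ id
  out∘out⁻¹ = trans unfold-commute (trans id+₁∘id+₁ (trans (+₁-cong₂ refl out⁻¹∘out) +₁-identity))

  out-mono : ∀ {A} {f g : A ⇒ D} → out ∘ f ≈ out ∘ g → f ≈ g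
  out-mono = section⇒mono out⁻¹∘out

  now : X ⇒ D
  now = out⁻¹ ∘ i₁

  later : D ⇒ D
  later = out⁻¹ ∘ i₂

  out∘now : out ∘ now ≈ i₁
  out∘now = cancelˡ out∘out⁻¹

  out∘later : out ∘ later ≈ i₂
  out∘later = cancelˡ out∘out⁻¹

  unfold-now : ∀ {A B} {c : A ⇒ X + A} {j : B ⇒ A} {f : B ⇒ X} → c ∘ j ≈ i₁ ∘ f → unfold c ∘ j ≈ now ∘ f
  unfold-now {c = c} {j} {f} p = out-mono (begin
    out ∘ (unfold c ∘ j)        ≈⟨ out∘unfold∘ ⟩
    (id +₁ unfold c) ∘ (c ∘ j)  ≈⟨ refl⟩∘⟨ p ⟩
    (id +₁ unfold c) ∘ (i₁ ∘ f) ≈⟨ pullˡ inject₁ ⟩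
    (i₁ ∘ id) ∘ f               ≈⟨ identityʳ ⟩∘⟨refl ⟩
    i₁ ∘ f                      ≈⟨ pullˡ out∘now ⟨
    out ∘ (now ∘ f)             ∎)

  unfold-later : ∀ {A B} {c : A ⇒ X + A} {j k : B ⇒ A} → c ∘ j ≈ i₂ ∘ k → unfold c ∘ j ≈ later ∘ (unfold c ∘ k)
  unfold-later {c = c} {j} {k} p = out-mono (begin
    out ∘ (unfold c ∘ j)           ≈⟨ out∘unfold∘ ⟩
    (id +₁ unfold c) ∘ (c ∘ j)     ≈⟨ refl⟩∘⟨ p ⟩
    (id +₁ unfold c) ∘ (i₂ ∘ k)    ≈⟨ pullˡ inject₂ ⟩
    (i₂ ∘ unfold c) ∘ k            ≈⟨ assoc ⟩
    i₂ ∘ (unfold c ∘ k)            ≈⟨ pullˡ out∘later ⟨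
    out ∘ (later ∘ (unfold c ∘ k)) ∎)

  apo-unique : ∀ {A} {c : A ⇒ X + (D + A)} {h h' : A ⇒ D} →
               out ∘ h ≈ (id +₁ [ id , h ]) ∘ c → out ∘ h' ≈ (id +₁ [ id , h' ]) ∘ c → h ≈ h'
  apo-unique {A} {c} {h} {h'} p p' = begin
    h                ≈⟨ inject₂ ⟨
    [ id , h ] ∘ i₂  ≈⟨ unfold-unique₂ (copairing-is-coalgebra-map p) (copairing-is-coalgebra-map p') ⟩∘⟨refl ⟩
    [ id , h' ] ∘ i₂ ≈⟨ inject₂ ⟩
    h'               ∎
    where
    copairing-is-coalgebra-map : ∀ {k : A ⇒ D} → out ∘ k ≈ (id +₁ [ id , k ]) ∘ c →
      out ∘ [ id , k ] ≈ (id +₁ [ id , k ]) ∘ [ (id +₁ i₁) ∘ out , c ]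
    copairing-is-coalgebra-map {k} q = +-jointly-epic
      (begin
        (out ∘ [ id , k ]) ∘ i₁                              ≈⟨ pullʳ inject₁ ⟩
        out ∘ id                                             ≈⟨ identityʳ ⟩
        out                                                  ≈⟨ identityˡ ⟨
        id ∘ out                                             ≈⟨ trans (+₁-cong₂ refl inject₁) +₁-identity ⟩∘⟨refl ⟨
        (id +₁ [ id , k ] ∘ i₁) ∘ out                        ≈⟨ pullˡ id+₁∘id+₁ ⟨
        (id +₁ [ id , k ]) ∘ ((id +₁ i₁) ∘ out)              ≈⟨ pullʳ inject₁ ⟨
        ((id +₁ [ id , k ]) ∘ [ (id +₁ i₁) ∘ out , c ]) ∘ i₁ ∎)
      (begin
        (out ∘ [ id , k ]) ∘ i₂                              ≈⟨ pullʳ inject₂ ⟩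
        out ∘ k                                              ≈⟨ q ⟩
        (id +₁ [ id , k ]) ∘ c                               ≈⟨ pullʳ inject₂ ⟨
        ((id +₁ [ id , k ]) ∘ [ (id +₁ i₁) ∘ out , c ]) ∘ i₂ ∎)

module DelayLemmas {o ℓ e : Level} {C : Category o ℓ e} (Pr : BinaryProducts C) (K : BinaryCoproducts C) where
  open Category C
  open HomLemmas C
  open BinaryProducts Pr
  open BinaryCoproducts K
  open ProductLemmas Pr
  open CoproductLemmas K

  module _ (F : ∀ X → FinalCoalgebra C K X)
           (dstr : ∀ {X Y Z} → X × (Y + Z) ⇒ X × Y + X × Z)
           (dstr-inverseˡ : ∀ {X Y Z} → dstr {X} {Y} {Z} ∘ [ id ⁂ i₁ , id ⁂ i₂ ] ≈ id)
           (dstr-inverseʳ : ∀ {X Y Z} → [ id ⁂ i₁ , id ⁂ i₂ ] ∘ dstr {X} {Y} {Z} ≈ id) where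
    open Delay C Pr K F dstr
    module FinalCoalgebraOf {X : Obj} = FinalCoalgebraLemmas (F X)
    open FinalCoalgebraOf using (out⁻¹; out⁻¹∘out; out-mono; now; later; out∘now; out∘later; out∘unfold∘;
                                 coalgebra-endo≈id; unfold-now; unfold-later; apo-unique)

    -- out₂ exhibits A × D X as a coproduct of A × X and A × D X with injections id ⁂ now and id ⁂ later.
    out₂ : ∀ {A X} → A × D X ⇒ A × X + A × D X
    out₂ = dstr ∘ (id ⁂ out)

    out₂∘now : ∀ {A X} → out₂ ∘ (id {A} ⁂ now {X}) ≈ i₁
    out₂∘now = trans (pullʳ (trans second∘second (⁂-cong₂ refl out∘now))) (trans (refl⟩∘⟨ sym inject₁) (cancelˡ dstr-inverseˡ))

    out₂∘later : ∀ {A X} → out₂ ∘ (id {A} ⁂ later {X}) ≈ i₂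
    out₂∘later = trans (pullʳ (trans second∘second (⁂-cong₂ refl out∘later))) (trans (refl⟩∘⟨ sym inject₂) (cancelˡ dstr-inverseˡ))

    [now,later]∘out₂ : ∀ {A X} → [ id {A} ⁂ now {X} , id ⁂ later ] ∘ out₂ ≈ id
    [now,later]∘out₂ = begin
      [ id ⁂ now , id ⁂ later ] ∘ out₂                             ≈⟨ trans ∘[] ([]-cong₂ second∘second second∘second) ⟩∘⟨refl ⟨
      ((id ⁂ out⁻¹) ∘ [ id ⁂ i₁ , id ⁂ i₂ ]) ∘ (dstr ∘ (id ⁂ out)) ≈⟨ pullʳ (cancelˡ dstr-inverseʳ) ⟩
      (id ⁂ out⁻¹) ∘ (id ⁂ out)                                    ≈⟨ second∘second ⟩
      id ⁂ (out⁻¹ ∘ out)                                           ≈⟨ ⁂-cong₂ refl out⁻¹∘out ⟩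
      id ⁂ id                                                      ≈⟨ ⁂-identity ⟩
      id                                                           ∎

    now-later-jointly-epic : ∀ {A X Z} {h h' : A × D X ⇒ Z} →
      h ∘ (id ⁂ now) ≈ h' ∘ (id ⁂ now) → h ∘ (id ⁂ later) ≈ h' ∘ (id ⁂ later) → h ≈ h'
    now-later-jointly-epic p q = retraction⇒epi [now,later]∘out₂
      (+-jointly-epic (trans (pullʳ inject₁) (trans p (sym (pullʳ inject₁))))
                      (trans (pullʳ inject₂) (trans q (sym (pullʳ inject₂)))))

    PreservesLater₁ : ∀ {A B Z} → D A × B ⇒ D Z → Set e
    PreservesLater₁ h = h ∘ (later ⁂ id) ≈ later ∘ h

    PreservesLater₂ : ∀ {A B Z} → A × D B ⇒ D Z → Set e
    PreservesLater₂ h = h ∘ (id ⁂ later) ≈ later ∘ h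

    ∘-preserves-later : ∀ {B W Z} {h : D W ⇒ D Z} {g : B ⇒ D W} {j : B ⇒ B} →
      h ∘ later ≈ later ∘ h → g ∘ j ≈ later ∘ g → (h ∘ g) ∘ j ≈ later ∘ (h ∘ g)
    ∘-preserves-later {h = h} {g} {j} p q = begin
      (h ∘ g) ∘ j     ≈⟨ pullʳ q ⟩
      h ∘ (later ∘ g) ≈⟨ pullˡ p ⟩
      (later ∘ h) ∘ g ≈⟨ assoc ⟩
      later ∘ (h ∘ g) ∎

    τ-now : ∀ {A X} → τ {A} {X} ∘ (id ⁂ now) ≈ now
    τ-now = trans (unfold-now (trans out₂∘now (sym identityʳ))) identityʳ

    τ-later : ∀ {A X} → PreservesLater₂ (τ {A} {X})
    τ-later = trans (unfold-later (trans out₂∘later (sym identityʳ))) (refl⟩∘⟨ identityʳ)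

    Dmap-now : ∀ {X Y} {f : X ⇒ Y} → Dmap f ∘ now ≈ now ∘ f
    Dmap-now = unfold-now (trans (pullʳ out∘now) inject₁)

    Dmap-later : ∀ {X Y} {f : X ⇒ Y} → Dmap f ∘ later ≈ later ∘ Dmap f
    Dmap-later = trans (unfold-later (trans (pullʳ out∘later) inject₂)) (refl⟩∘⟨ identityʳ)

    τ̂-now : ∀ {X B} → τ̂ {X} {B} ∘ (now ⁂ id) ≈ now
    τ̂-now = begin
      (Dmap swap ∘ (τ ∘ swap)) ∘ (now ⁂ id) ≈⟨ pullʳ (extendʳ swap∘⁂) ⟩
      Dmap swap ∘ ((τ ∘ (id ⁂ now)) ∘ swap) ≈⟨ refl⟩∘⟨ (τ-now ⟩∘⟨refl) ⟩
      Dmap swap ∘ (now ∘ swap)              ≈⟨ pullˡ Dmap-now ⟩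
      (now ∘ swap) ∘ swap                   ≈⟨ cancelʳ swap∘swap ⟩
      now                                   ∎

    τ̂-later : ∀ {X B} → PreservesLater₁ (τ̂ {X} {B})
    τ̂-later = ∘-preserves-later Dmap-later (trans (extendʳ swap∘⁂) (trans (τ-later ⟩∘⟨refl) assoc))

    module Kleisli {X Y : Obj} (f : X ⇒ D Y) where
      private
        d : D X + D Y ⇒ Y + (D X + D Y)
        d = [ [ (id +₁ i₂) ∘ out ∘ f , i₂ ∘ i₁ ] ∘ out , (id +₁ i₂) ∘ out ]

        u : D X + D Y ⇒ D Y
        u = unfold d

        u∘i₂ : u ∘ i₂ ≈ id
        u∘i₂ = coalgebra-endo≈id (trans out∘unfold∘ (trans (refl⟩∘⟨ inject₂) (pullˡ id+₁∘id+₁)))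

      *-now : f * ∘ now ≈ f
      *-now = out-mono (begin
        out ∘ ((u ∘ i₁) ∘ now)               ≈⟨ refl⟩∘⟨ assoc ⟩
        out ∘ (u ∘ (i₁ ∘ now))               ≈⟨ out∘unfold∘ ⟩
        (id +₁ u) ∘ (d ∘ (i₁ ∘ now))         ≈⟨ refl⟩∘⟨ trans (pullˡ inject₁) (trans (pullʳ out∘now) inject₁) ⟩
        (id +₁ u) ∘ ((id +₁ i₂) ∘ (out ∘ f)) ≈⟨ pullˡ id+₁∘id+₁ ⟩
        (id +₁ u ∘ i₂) ∘ (out ∘ f)           ≈⟨ trans (+₁-cong₂ refl u∘i₂) +₁-identity ⟩∘⟨refl ⟩
        id ∘ (out ∘ f)                       ≈⟨ identityˡ ⟩
        out ∘ f                              ∎)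

      *-later : f * ∘ later ≈ later ∘ f *
      *-later = trans assoc (unfold-later (trans (pullˡ inject₁) (trans (pullʳ out∘later) inject₂)))

    open Kleisli using (*-now; *-later)

    *∘τ-now : ∀ {A X Y} {f : A × X ⇒ D Y} → (f * ∘ τ) ∘ (id ⁂ now) ≈ f
    *∘τ-now = trans (pullʳ τ-now) (*-now _)

    *∘τ-later : ∀ {A X Y} {f : A × X ⇒ D Y} → PreservesLater₂ (f * ∘ τ)
    *∘τ-later = ∘-preserves-later (*-later _) τ-later

    *∘τ̂-now : ∀ {X B Y} {f : X × B ⇒ D Y} → (f * ∘ τ̂) ∘ (now ⁂ id) ≈ f
    *∘τ̂-now = trans (pullʳ τ̂-now) (*-now _)

    *∘τ̂-later : ∀ {X B Y} {f : X × B ⇒ D Y} → PreservesLater₁ (f * ∘ τ̂)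
    *∘τ̂-later = ∘-preserves-later (*-later _) τ̂-later

    preservesLater₂-unique : ∀ {A B Z} {k k' : A × D B ⇒ D Z} →
      PreservesLater₂ k → PreservesLater₂ k' → k ∘ (id ⁂ now) ≈ k' ∘ (id ⁂ now) → k ≈ k'
    preservesLater₂-unique {A} {B} {Z} {k} {k'} p p' q = apo-unique (is-apomorphism p refl) (is-apomorphism p' (sym q))
      where
      g : A × B ⇒ D Z
      g = k ∘ (id ⁂ now)

      -- On (a , now b) hand over to g (a , b); on (a , later q) emit one step and continue at (a , q).
      c : A × D B ⇒ Z + (D Z + A × D B)
      c = [ (id +₁ i₁) ∘ (out ∘ g) , i₂ ∘ i₂ ] ∘ out₂

      is-apomorphism : ∀ {h} → PreservesLater₂ h → h ∘ (id ⁂ now) ≈ g → out ∘ h ≈ (id +₁ [ id , h ]) ∘ c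
      is-apomorphism {h} ph r = now-later-jointly-epic
        (begin
          (out ∘ h) ∘ (id ⁂ now)                        ≈⟨ pullʳ r ⟩
          out ∘ g                                       ≈⟨ identityˡ ⟨
          id ∘ (out ∘ g)                                ≈⟨ trans (+₁-cong₂ refl inject₁) +₁-identity ⟩∘⟨refl ⟨
          (id +₁ [ id , h ] ∘ i₁) ∘ (out ∘ g)           ≈⟨ pullˡ id+₁∘id+₁ ⟨
          (id +₁ [ id , h ]) ∘ ((id +₁ i₁) ∘ (out ∘ g)) ≈⟨ refl⟩∘⟨ trans (pullʳ out₂∘now) inject₁ ⟨
          (id +₁ [ id , h ]) ∘ (c ∘ (id ⁂ now))         ≈⟨ sym-assoc ⟩
          ((id +₁ [ id , h ]) ∘ c) ∘ (id ⁂ now)         ∎)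
        (begin
          (out ∘ h) ∘ (id ⁂ later)                ≈⟨ pullʳ ph ⟩
          out ∘ (later ∘ h)                       ≈⟨ pullˡ out∘later ⟩
          i₂ ∘ h                                  ≈⟨ pullʳ inject₂ ⟨
          (i₂ ∘ [ id , h ]) ∘ i₂                  ≈⟨ pullˡ inject₂ ⟨
          (id +₁ [ id , h ]) ∘ (i₂ ∘ i₂)          ≈⟨ refl⟩∘⟨ trans (pullʳ out₂∘later) inject₂ ⟨
          (id +₁ [ id , h ]) ∘ (c ∘ (id ⁂ later)) ≈⟨ sym-assoc ⟩
          ((id +₁ [ id , h ]) ∘ c) ∘ (id ⁂ later) ∎)

    preservesLater₁-unique : ∀ {A B Z} {k k' : D A × B ⇒ D Z} →
      PreservesLater₁ k → PreservesLater₁ k' → k ∘ (now ⁂ id) ≈ k' ∘ (now ⁂ id) → k ≈ k'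
    preservesLater₁-unique p p' q = retraction⇒epi swap∘swap
      (preservesLater₂-unique (swapped p) (swapped p') (trans (extendʳ swap∘⁂) (trans (q ⟩∘⟨refl) (sym (extendʳ swap∘⁂)))))
      where
      swapped : ∀ {A B Z} {k : D A × B ⇒ D Z} → PreservesLater₁ k → PreservesLater₂ (k ∘ swap)
      swapped p = trans (extendʳ swap∘⁂) (trans (p ⟩∘⟨refl) assoc)

    preservesLater₂-∘first : ∀ {A A' B Z} {k : A' × D B ⇒ D Z} {f : A ⇒ A'} →
      PreservesLater₂ k → PreservesLater₂ (k ∘ (f ⁂ id))
    preservesLater₂-∘first p = trans (extendʳ first↔second) (trans (p ⟩∘⟨refl) assoc)

    preservesLater₁-∘second : ∀ {A B B' Z} {k : D A × B' ⇒ D Z} {f : B ⇒ B'} →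
      PreservesLater₁ k → PreservesLater₁ (k ∘ (id ⁂ f))
    preservesLater₁-∘second p = trans (extendʳ (sym first↔second)) (trans (p ⟩∘⟨refl) assoc)

    preservesLater₁-from-now : ∀ {A B Z} {k : D A × D B ⇒ D Z} {g : D A × B ⇒ D Z} →
      PreservesLater₂ k → k ∘ (id ⁂ now) ≈ g → PreservesLater₁ g → PreservesLater₁ k
    preservesLater₁-from-now {k = k} {g} p q r =
      preservesLater₂-unique (preservesLater₂-∘first p) (∘-preserves-later refl p) (begin
        (k ∘ (later ⁂ id)) ∘ (id ⁂ now) ≈⟨ extendʳ first↔second ⟩
        (k ∘ (id ⁂ now)) ∘ (later ⁂ id) ≈⟨ q ⟩∘⟨refl ⟩
        g ∘ (later ⁂ id)                ≈⟨ r ⟩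
        later ∘ g                       ≈⟨ refl⟩∘⟨ q ⟨
        later ∘ (k ∘ (id ⁂ now))        ≈⟨ sym-assoc ⟩
        (later ∘ k) ∘ (id ⁂ now)        ∎)

    preservesLater₂-from-now : ∀ {A B Z} {k : D A × D B ⇒ D Z} {g : A × D B ⇒ D Z} →
      PreservesLater₁ k → k ∘ (now ⁂ id) ≈ g → PreservesLater₂ g → PreservesLater₂ k
    preservesLater₂-from-now {k = k} {g} p q r =
      preservesLater₁-unique (preservesLater₁-∘second p) (∘-preserves-later refl p) (begin
        (k ∘ (id ⁂ later)) ∘ (now ⁂ id) ≈⟨ extendʳ (sym first↔second) ⟩
        (k ∘ (now ⁂ id)) ∘ (id ⁂ later) ≈⟨ q ⟩∘⟨refl ⟩
        g ∘ (id ⁂ later)                ≈⟨ r ⟩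
        later ∘ g                       ≈⟨ refl⟩∘⟨ q ⟨
        later ∘ (k ∘ (now ⁂ id))        ≈⟨ sym-assoc ⟩
        (later ∘ k) ∘ (now ⁂ id)        ∎)

    preservesLater-unique : ∀ {A B Z} {h h' : D A × D B ⇒ D Z} →
      PreservesLater₁ h → PreservesLater₂ h → PreservesLater₁ h' → PreservesLater₂ h' →
      h ∘ (now ⁂ now) ≈ h' ∘ (now ⁂ now) → h ≈ h'
    preservesLater-unique p₁ p₂ p₁' p₂' q = preservesLater₁-unique p₁ p₁'
      (preservesLater₂-unique (preservesLater₂-∘first p₂) (preservesLater₂-∘first p₂')
        (trans (pullʳ first∘second) (trans q (sym (pullʳ first∘second)))))

    commutative : Commutative
    commutative {X} {Y} = preservesLater-unique L₁ L₂ R₁ R₂ (trans L-now (sym R-now))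
      where
      L R : D X × D Y ⇒ D (X × Y)
      L = τ̂ * ∘ τ
      R = τ * ∘ τ̂

      L₂ : PreservesLater₂ L
      L₂ = *∘τ-later

      L₁ : PreservesLater₁ L
      L₁ = preservesLater₁-from-now L₂ *∘τ-now τ̂-later

      R₁ : PreservesLater₁ R
      R₁ = *∘τ̂-later

      R₂ : PreservesLater₂ R
      R₂ = preservesLater₂-from-now R₁ *∘τ̂-now τ-later

      L-now : L ∘ (now ⁂ now) ≈ now
      L-now = begin
        L ∘ (now ⁂ now)               ≈⟨ pushʳ second∘first ⟩
        (L ∘ (id ⁂ now)) ∘ (now ⁂ id) ≈⟨ *∘τ-now ⟩∘⟨refl ⟩
        τ̂ ∘ (now ⁂ id)                ≈⟨ τ̂-now ⟩
        now                           ∎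

      R-now : R ∘ (now ⁂ now) ≈ now
      R-now = begin
        R ∘ (now ⁂ now)               ≈⟨ pushʳ first∘second ⟩
        (R ∘ (now ⁂ id)) ∘ (id ⁂ now) ≈⟨ *∘τ̂-now ⟩∘⟨refl ⟩
        τ ∘ (id ⁂ now)                ≈⟨ τ-now ⟩
        now                           ∎

-- The natural number object and the exponentials are used in the paper only to construct the
-- final coalgebras D X, and extensivity only to make dstr an isomorphism; both are supplied directly.
proposition3p2 : ∀ {o ℓ e : Level} (C : Category o ℓ e)
    (T : Terminal C) (Pr : BinaryProducts C) (E : Extensive C)
    (nno : StableNNO C T Pr)
    (exp : ∀ X → Exponential C T Pr X (StableNNO.ℕ nno))
    (F : ∀ X → FinalCoalgebra C (Extensive.coproducts E) X)
    (dstr : ∀ {X Y Z} → Category._⇒_ C (BinaryProducts._×_ Pr X (BinaryCoproducts._+_ (Extensive.coproducts E) Y Z)) (BinaryCoproducts._+_ (Extensive.coproducts E) (BinaryProducts._×_ Pr X Y) (BinaryProducts._×_ Pr X Z)))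
    (dstr-inverseˡ : ∀ {X Y Z} → Category._≈_ C (Category._∘_ C (dstr {X} {Y} {Z}) (BinaryCoproducts.[_,_] (Extensive.coproducts E) (BinaryProducts._⁂_ Pr (Category.id C) (BinaryCoproducts.i₁ (Extensive.coproducts E))) (BinaryProducts._⁂_ Pr (Category.id C) (BinaryCoproducts.i₂ (Extensive.coproducts E))))) (Category.id C))
    (dstr-inverseʳ : ∀ {X Y Z} → Category._≈_ C (Category._∘_ C (BinaryCoproducts.[_,_] (Extensive.coproducts E) (BinaryProducts._⁂_ Pr (Category.id C) (BinaryCoproducts.i₁ (Extensive.coproducts E))) (BinaryProducts._⁂_ Pr (Category.id C) (BinaryCoproducts.i₂ (Extensive.coproducts E)))) (dstr {X} {Y} {Z})) (Category.id C))
    → Delay.Commutative C Pr (Extensive.coproducts E) F dstr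
proposition3p2 C _ Pr E _ _ F dstr dstr-inverseˡ dstr-inverseʳ =
  DelayLemmas.commutative Pr (Extensive.coproducts E) F dstr dstr-inverseˡ dstr-inverseʳ
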